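{- Consider a directed graph (self-loops allowed) in which no path of length less than $l_{*}$ has more than one cycle inducing edge. Then every path $P$ of length less than $\frac{l_{*}}{2}$ has a decomposition $P=(P_{1},C,\dots,C,P_{2})$, i.e. $P$ is the concatenation of a simple path $P_{1}$, some number $k\ge 0$ of copies of a simple cycle $C$, and a simple path $P_{2}$.
   Context: A path of length $r$ in a directed graph is a sequence of nodes $(i_0,\dots,i_r)$ (repetitions allowed) with every edge $i_{k-1}\to i_k$ present; a simple path is a path with no repeated node. A simple cycle is a path that begins and ends at the same node and visits no other node more than once. The minimal edge list of a path is the ordered list of its distinct edges obtained by traversing the path's edges in order and appending each edge the first time it is encountered. In a list of edges, the $m$-th edge is cycle inducing if there is a simple cycle containing that edge and using only the first $m$ edges of the list; an edge of a path is cycle inducing if it is cycle inducing in the path's minimal edge list. -}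

module Defs where

open import Data.Nat using (ℕ; zero; suc)
open import Data.Fin using (Fin; toℕ)
import Data.Fin as F
open import Data.Product using (_×_; _,_; proj₁; proj₂; Σ; ∃)
open import Data.Product.Properties using (≡-dec)
open import Data.List using (List; []; _∷_; _++_; [_]; length; lookup; take; deduplicate; foldl)
open import Data.List.Relation.Unary.All using (All)
open import Data.List.Membership.Propositional using (_∈_)
open import Data.List.Relation.Unary.Unique.Propositional using (Unique)
open import Relation.Nullary using (Dec)
open import Relation.Binary.PropositionalEquality using (_≡_; _≢_)

Graph : ℕ → Set₁
Graph n = Fin n → Fin n → Set

Edge : ℕ → Set
Edge n = Fin n × Fin n

_≟E_ : ∀ {n} (e f : Edge n) → Dec (e ≡ f)
_≟E_ = ≡-dec F._≟_ F._≟_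

-- A path (i₀, i₁, …, i_r) is represented by its start node i₀ and the
-- list of remaining nodes (i₁, …, i_r); its length is r = length of that list.

edgesOf : ∀ {n} → Fin n → List (Fin n) → List (Edge n)
edgesOf i []       = []
edgesOf i (j ∷ js) = (i , j) ∷ edgesOf j js

endpoint : ∀ {n} → Fin n → List (Fin n) → Fin n
endpoint i js = foldl (λ _ x → x) i js

IsPath : ∀ {n} → Graph n → Fin n → List (Fin n) → Set
IsPath G i js = All (λ e → G (proj₁ e) (proj₂ e)) (edgesOf i js)

IsSimplePath : ∀ {n} → Graph n → Fin n → List (Fin n) → Set
IsSimplePath G i js = IsPath G i js × Unique (i ∷ js)

IsSimpleCycle : ∀ {n} → Graph n → Fin n → List (Fin n) → Set
IsSimpleCycle G i js =
  IsPath G i js × Unique js × Σ (List _) (λ ks → js ≡ ks ++ [ i ])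

EdgesIn : ∀ {n} → List (Edge n) → Graph n
EdgesIn L i j = (i , j) ∈ L

minimalEdgeList : ∀ {n} → Fin n → List (Fin n) → List (Edge n)
minimalEdgeList i js = deduplicate _≟E_ (edgesOf i js)

-- the m-th edge of L (0-indexed position m, i.e. the (m+1)-th edge) is cycle
-- inducing: some simple cycle contains it and uses only the first m+1 edges of L
CycleInducing : ∀ {n} (L : List (Edge n)) → Fin (length L) → Set
CycleInducing {n} L m =
  Σ (Fin n) λ i → Σ (List (Fin n)) λ js →
    IsSimpleCycle (EdgesIn (take (suc (toℕ m)) L)) i js
    × lookup L m ∈ edgesOf i js

-- the path (i, js) has more than one cycle inducing edge
-- (the minimal edge list has distinct entries, so distinct positions = distinct edges)
MoreThanOneCycleInducing : ∀ {n} → Fin n → List (Fin n) → Set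
MoreThanOneCycleInducing i js =
  let L = minimalEdgeList i js in
  Σ (Fin (length L)) λ m₁ → Σ (Fin (length L)) λ m₂ →
    m₁ ≢ m₂ × CycleInducing L m₁ × CycleInducing L m₂

repeatSteps : ∀ {n} → ℕ → List (Fin n) → List (Fin n)
repeatSteps zero  cs = []
repeatSteps (suc k) cs = cs ++ repeatSteps k cs

module Submission where

-- Call a step of a walk *closing* if it uses an edge not used
-- before and enters a node visited before.  Such an edge is cycle inducing:
-- loop-erasing the walk from the entered node back to the edge's source and
-- closing it with the edge gives a simple cycle built from the edges seen so
-- far.  Hence, when no walk of length < l* has two cycle inducing edges (the
-- theorem only needs this for the walk itself), a walk has at most one closing
-- edge.  Cut the walk at its first repeated node: a simple stem, a simple
-- cycle C, and a remainder.  The closing edge of C is the unique one, so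
-- afterwards every step either reuses an old edge or enters a fresh node.  Old
-- edges leaving cycle nodes are cycle edges, so the walk winds around C some
-- number of times, then follows part of C; if it then leaves C it does so by
-- a new edge into a fresh node, after which every node is fresh.  The part
-- after the last full round is therefore a simple path.

open import Defs
open import Data.Nat using (ℕ; _<_; _≤_; _*_; suc; zero; s≤s)
open import Data.Nat.Properties using (≤-<-trans; m≤n*m; m≤n+m)
open import Data.Nat.Induction using (<-wellFounded)
open import Induction.WellFounded using (Acc; acc)
open import Data.Fin using (Fin; toℕ)
import Data.Fin as F
open import Data.List using (List; []; _∷_; length; _++_; [_]; lookup; take; deduplicate; filter; map)
open import Data.List.Properties using (∷-injectiveˡ; ∷-injectiveʳ; ++-assoc; ++-identityʳ; filter-++; filter-accept; foldl-++; length-++)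
open import Data.List.Relation.Unary.Any using (here; there)
open import Data.List.Relation.Unary.All using (All; []; _∷_)
import Data.List.Relation.Unary.All as All
open import Data.List.Relation.Unary.All.Properties using (++⁻ˡ; ++⁻ʳ; ¬Any⇒All¬)
open import Data.List.Relation.Unary.Unique.Propositional using (Unique; []; _∷_)
open import Data.List.Relation.Unary.Unique.Propositional.Properties using (Unique[x∷xs]⇒x∉xs)
import Data.List.Relation.Unary.Unique.Propositional.Properties as Unique
open import Data.List.Relation.Binary.Disjoint.Propositional using (Disjoint)
open import Data.List.Relation.Binary.Subset.Propositional using (_⊆_)
open import Data.List.Membership.Propositional using (_∈_; _∉_)
open import Data.List.Membership.Propositional.Properties using (∈-∃++; ∈-++⁺ˡ; ∈-++⁺ʳ; ∈-++⁻; ∈-map⁺; ∈-deduplicate⁺)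
open import Data.Product using (Σ; _×_; _,_; proj₁)
open import Data.Sum using (_⊎_; inj₁; inj₂)
open import Data.Empty using (⊥-elim)
open import Relation.Nullary using (¬_; Dec; yes; no; ¬?)
open import Relation.Binary.PropositionalEquality using (_≡_; _≢_; refl; sym; trans; cong; subst; module ≡-Reasoning)
open import Function using (_∘_; id)

unique-++ˡ : ∀ {A : Set} (xs : List A) {ys} → Unique (xs ++ ys) → Unique xs
unique-++ˡ []       u       = []
unique-++ˡ (x ∷ xs) (a ∷ u) = ++⁻ˡ xs a ∷ unique-++ˡ xs u

unique-++ʳ : ∀ {A : Set} (xs : List A) {ys} → Unique (xs ++ ys) → Unique ys
unique-++ʳ []       u       = u
unique-++ʳ (x ∷ xs) (a ∷ u) = unique-++ʳ xs u

unique-disjoint : ∀ {A : Set} (xs : List A) {ys} → Unique (xs ++ ys) → Disjoint xs ys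
unique-disjoint (x ∷ xs) (a ∷ u) (here refl , v∈ys) = All.lookup (++⁻ʳ xs a) v∈ys refl
unique-disjoint (x ∷ xs) (a ∷ u) (there v∈xs , v∈ys) = unique-disjoint xs u (v∈xs , v∈ys)

unique-rotate : ∀ {A : Set} {z : A} {K} → Unique (z ∷ K) → Unique (K ++ [ z ])
unique-rotate u@(_ ∷ uK) =
  Unique.++⁺ uK ([] ∷ []) (λ { (z∈K , here refl) → Unique[x∷xs]⇒x∉xs u z∈K })

position : ∀ {A : Set} (L Xs : List A) e Z → L ≡ Xs ++ e ∷ Z →
  Σ (Fin (length L)) λ m → lookup L m ≡ e × take (suc (toℕ m)) L ≡ Xs ++ [ e ]
position _ []       e Z refl = F.zero , refl , refl
position _ (x ∷ Xs) e Z refl with position _ Xs e Z refl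
... | m , at , upTo = F.suc m , at , cong (x ∷_) upTo

record Deviation {A : Set} (cs r : List A) : Set where
  field
    agreed unused after : List A
    expected : A
    cs-split : cs ≡ agreed ++ expected ∷ unused
    r-split : r ≡ agreed ++ after
    leaves : ∀ {y q} → after ≡ y ∷ q → y ≢ expected

matchPrefix : ∀ {A : Set} (_≟_ : (x y : A) → Dec (x ≡ y)) (cs r : List A) →
  (Σ (List A) λ r' → r ≡ cs ++ r') ⊎ Deviation cs r
matchPrefix _≟_ []       r       = inj₁ (r , refl)
matchPrefix _≟_ (x ∷ cs) []      = inj₂ (record
  { agreed = []; unused = cs; after = []; expected = x
  ; cs-split = refl; r-split = refl; leaves = λ () })
matchPrefix _≟_ (x ∷ cs) (y ∷ r) with y ≟ x
... | no y≢x = inj₂ (record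
  { agreed = []; unused = cs; after = y ∷ r; expected = x
  ; cs-split = refl; r-split = refl; leaves = λ { refl → y≢x } })
... | yes refl with matchPrefix _≟_ cs r
...   | inj₁ (r' , r≡) = inj₁ (r' , cong (y ∷_) r≡)
...   | inj₂ d = inj₂ (record
  { agreed = y ∷ agreed; unused = unused; after = after; expected = expected
  ; cs-split = cong (y ∷_) cs-split; r-split = cong (y ∷_) r-split; leaves = leaves })
  where open Deviation d

prepend-longer : ∀ {A : Set} (cs : List A) → cs ≢ [] → ∀ r → length r < length (cs ++ r)
prepend-longer []       nonempty r = ⊥-elim (nonempty refl)
prepend-longer (c ∷ cs) _        r =
  s≤s (subst (length r ≤_) (sym (length-++ cs)) (m≤n+m (length r) (length cs)))

prefix-of-snoc : ∀ {A : Set} (K : List A) z a x r' → a ++ x ∷ r' ≡ K ++ [ z ] → Σ (List A) λ t → K ≡ a ++ t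
prefix-of-snoc K       z []      x r' eq = K , refl
prefix-of-snoc []      z (_ ∷ []) x r' ()
prefix-of-snoc []      z (_ ∷ _ ∷ _) x r' ()
prefix-of-snoc (k ∷ K) z (a₀ ∷ a) x r' eq with prefix-of-snoc K z a x r' (∷-injectiveʳ eq)
... | t , K≡ = t , trans (cong (_∷ K) (sym (∷-injectiveˡ eq))) (cong (a₀ ∷_) K≡)

snoc≢[] : ∀ {A : Set} (K : List A) z → K ++ [ z ] ≢ []
snoc≢[] []      z ()
snoc≢[] (_ ∷ _) z ()

module _ {n : ℕ} where
  open import Data.List.Membership.DecPropositional (F._≟_ {n}) using (_∈?_)

  endpoint-++ : ∀ (i : Fin n) xs ys → endpoint i (xs ++ ys) ≡ endpoint (endpoint i xs) ys
  endpoint-++ i xs ys = foldl-++ _ i xs ys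

  edgesOf-++ : ∀ (i : Fin n) xs ys → edgesOf i (xs ++ ys) ≡ edgesOf i xs ++ edgesOf (endpoint i xs) ys
  edgesOf-++ i []       ys = refl
  edgesOf-++ i (x ∷ xs) ys = cong ((i , x) ∷_) (edgesOf-++ x xs ys)

  edgesOf-prefix : ∀ (i : Fin n) xs ys → edgesOf i xs ⊆ edgesOf i (xs ++ ys)
  edgesOf-prefix i xs ys e∈ = subst (_ ∈_) (sym (edgesOf-++ i xs ys)) (∈-++⁺ˡ e∈)

  edgesOf-suffix : ∀ (i : Fin n) xs ys → edgesOf (endpoint i xs) ys ⊆ edgesOf i (xs ++ ys)
  edgesOf-suffix i xs ys e∈ = subst (_ ∈_) (sym (edgesOf-++ i xs ys)) (∈-++⁺ʳ (edgesOf i xs) e∈)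

  lastEdge∈ : ∀ (i : Fin n) xs v → (endpoint i xs , v) ∈ edgesOf i (xs ++ [ v ])
  lastEdge∈ i xs v = edgesOf-suffix i xs [ v ] (here refl)

  isPath-prefix : ∀ (G : Graph n) i xs ys → IsPath G i (xs ++ ys) → IsPath G i xs
  isPath-prefix G i xs ys p = ++⁻ˡ (edgesOf i xs) (subst (All _) (edgesOf-++ i xs ys) p)

  isPath-suffix : ∀ (G : Graph n) i xs ys → IsPath G i (xs ++ ys) → IsPath G (endpoint i xs) ys
  isPath-suffix G i xs ys p = ++⁻ʳ (edgesOf i xs) (subst (All _) (edgesOf-++ i xs ys) p)

  isPath-edgesIn : ∀ (L : List (Edge n)) i xs → edgesOf i xs ⊆ L → IsPath (EdgesIn L) i xs
  isPath-edgesIn L i xs sub = All.tabulate sub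

  endpoint∈ : ∀ (i : Fin n) xs → endpoint i xs ∈ i ∷ xs
  endpoint∈ i []       = here refl
  endpoint∈ i (x ∷ xs) = there (endpoint∈ x xs)

  source∈ : ∀ {s t} (i : Fin n) xs → (s , t) ∈ edgesOf i xs → s ∈ i ∷ xs
  source∈ i (x ∷ xs) (here refl) = here refl
  source∈ i (x ∷ xs) (there p)   = there (source∈ x xs p)

  sources-snoc : ∀ (i : Fin n) xs v → map proj₁ (edgesOf i (xs ++ [ v ])) ≡ i ∷ xs
  sources-snoc i []       v = refl
  sources-snoc i (x ∷ xs) v = cong (i ∷_) (sources-snoc x xs v)

  simple-noExit : ∀ (i : Fin n) xs {y} → Unique (i ∷ xs) → (endpoint i xs , y) ∉ edgesOf i xs
  simple-noExit i (x ∷ xs) u (here eq) =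
    Unique[x∷xs]⇒x∉xs u (subst (_∈ x ∷ xs) (cong proj₁ eq) (endpoint∈ x xs))
  simple-noExit i (x ∷ xs) (_ ∷ u) (there p) = simple-noExit x xs u p

  functional : ∀ (es : List (Edge n)) {s t t'} → Unique (map proj₁ es) →
    (s , t) ∈ es → (s , t') ∈ es → t ≡ t'
  functional (_ ∷ es) u       (here refl) (here refl) = refl
  functional (_ ∷ es) (a ∷ u) (here refl) (there q)   = ⊥-elim (All.lookup a (∈-map⁺ proj₁ q) refl)
  functional (_ ∷ es) (a ∷ u) (there p)   (here refl) = ⊥-elim (All.lookup a (∈-map⁺ proj₁ p) refl)
  functional (_ ∷ es) (a ∷ u) (there p)   (there q)   = functional es u p q

  cycle-functional : ∀ (u : Fin n) xs v {s t t'} → Unique (u ∷ xs) →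
    (s , t) ∈ edgesOf u (xs ++ [ v ]) → (s , t') ∈ edgesOf u (xs ++ [ v ]) → t ≡ t'
  cycle-functional u xs v un = functional _ (subst Unique (sym (sources-snoc u xs v)) un)

  endpoint-repeat : ∀ (z : Fin n) cs k → endpoint z cs ≡ z → endpoint z (repeatSteps k cs) ≡ z
  endpoint-repeat z cs zero    closed = refl
  endpoint-repeat z cs (suc k) closed = begin
    endpoint z (cs ++ repeatSteps k cs)           ≡⟨ endpoint-++ z cs _ ⟩
    endpoint (endpoint z cs) (repeatSteps k cs)   ≡⟨ cong (λ c → endpoint c (repeatSteps k cs)) closed ⟩
    endpoint z (repeatSteps k cs)                 ≡⟨ endpoint-repeat z cs k closed ⟩
    z                                             ∎
    where open ≡-Reasoning

  edgesOf-repeat : ∀ (z : Fin n) cs k → endpoint z cs ≡ z → edgesOf z (repeatSteps k cs) ⊆ edgesOf z cs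
  edgesOf-repeat z cs (suc k) closed e∈ with ∈-++⁻ (edgesOf z cs) (subst (_ ∈_) (edgesOf-++ z cs _) e∈)
  ... | inj₁ e∈cs    = e∈cs
  ... | inj₂ e∈later = edgesOf-repeat z cs k closed (subst (λ c → _ ∈ edgesOf c (repeatSteps k cs)) closed e∈later)

  peelRounds : ∀ (cs : List (Fin n)) → cs ≢ [] →
    ∀ q → Σ ℕ λ k → Σ (List (Fin n)) λ r → q ≡ repeatSteps k cs ++ r × Deviation cs r
  peelRounds cs nonempty q = go q (<-wellFounded (length q))
    where
    go : ∀ q → Acc _<_ (length q) → Σ ℕ λ k → Σ (List (Fin n)) λ r → q ≡ repeatSteps k cs ++ r × Deviation cs r
    go q (acc smaller) with matchPrefix F._≟_ cs q
    ... | inj₂ d = 0 , q , refl , d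
    ... | inj₁ (q' , refl) with go q' (smaller (prepend-longer cs nonempty q'))
    ...   | k , r , q'≡ , d = suc k , r , trans (cong (cs ++_) q'≡) (sym (++-assoc cs (repeatSteps k cs) r)) , d

  splitAt∈ : ∀ (i : Fin n) xs {z} → z ∈ i ∷ xs →
    Σ (List (Fin n)) λ a → Σ (List (Fin n)) λ b → xs ≡ a ++ b × endpoint i a ≡ z
  splitAt∈ i xs       (here refl) = [] , xs , refl , refl
  splitAt∈ i (x ∷ xs) (there z∈) with splitAt∈ x xs z∈
  ... | a , b , xs≡ , end = x ∷ a , b , cong (x ∷_) xs≡ , end

  afterOccurrence : ∀ (b : Fin n) r P a Q → b ∷ r ≡ P ++ a ∷ Q →
    endpoint a Q ≡ endpoint b r × edgesOf a Q ⊆ edgesOf b r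
  afterOccurrence b r []      a Q refl = refl , id
  afterOccurrence b r (p ∷ P) a Q refl =
    sym (endpoint-++ b P (a ∷ Q)) , λ e∈ → edgesOf-suffix b P (a ∷ Q) (there e∈)

  loopErase : ∀ (a : Fin n) bs → Σ (List (Fin n)) λ bs' →
    Unique (a ∷ bs') × endpoint a bs' ≡ endpoint a bs × edgesOf a bs' ⊆ edgesOf a bs
  loopErase a [] = [] , [] ∷ [] , refl , id
  loopErase a (b ∷ bs) with loopErase b bs
  ... | r , ur , end , sub with a ∈? (b ∷ r)
  ...   | no a∉ = b ∷ r , ¬Any⇒All¬ (b ∷ r) a∉ ∷ ur , end , λ { (here eq) → here eq ; (there e∈) → there (sub e∈) }
  ...   | yes a∈ with ∈-∃++ a∈
  ...     | P , Q , split with afterOccurrence b r P a Q split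
  ...       | endQ , subQ = Q , unique-++ʳ P (subst Unique split ur) , trans endQ end , there ∘ sub ∘ subQ

  closingCycle : ∀ (i : Fin n) pre {z} → z ∈ i ∷ pre → (L : List (Edge n)) →
    edgesOf i pre ⊆ L → (endpoint i pre , z) ∈ L →
    Σ (List (Fin n)) λ cs → IsSimpleCycle (EdgesIn L) z cs × (endpoint i pre , z) ∈ edgesOf z cs
  closingCycle i pre {z} z∈ L walk⊆L e∈L with splitAt∈ i pre z∈
  ... | a , b , refl , end with loopErase z b
  ... | b' , ub' , end' , sub =
    b' ++ [ z ] , (isPath-edgesIn L z (b' ++ [ z ]) cycle⊆L , unique-rotate ub' , b' , refl) , e∈cycle
    where
    sameEnd : endpoint z b' ≡ endpoint i (a ++ b)
    sameEnd = trans end' (trans (cong (λ c → endpoint c b) (sym end)) (sym (endpoint-++ i a b)))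
    cycleEdges : edgesOf z (b' ++ [ z ]) ≡ edgesOf z b' ++ [ (endpoint i (a ++ b) , z) ]
    cycleEdges = trans (edgesOf-++ z b' [ z ]) (cong (λ c → edgesOf z b' ++ [ (c , z) ]) sameEnd)
    e∈cycle : (endpoint i (a ++ b) , z) ∈ edgesOf z (b' ++ [ z ])
    e∈cycle = subst (_ ∈_) (sym cycleEdges) (∈-++⁺ʳ (edgesOf z b') (here refl))
    cycle⊆L : edgesOf z (b' ++ [ z ]) ⊆ L
    cycle⊆L e∈ with ∈-++⁻ (edgesOf z b') (subst (_ ∈_) cycleEdges e∈)
    ... | inj₁ e∈b' = walk⊆L (edgesOf-suffix i a b (subst (λ c → _ ∈ edgesOf c b) (sym end) (sub e∈b')))
    ... | inj₂ (here refl) = e∈L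

  ClosingStep : Fin n → List (Fin n) → Fin n → Set
  ClosingStep i pre z = (endpoint i pre , z) ∉ edgesOf i pre × z ∈ i ∷ pre

  ClosingAt : Fin n → List (Fin n) → List (Fin n) → Fin n → Set
  ClosingAt i js pre z = Σ (List (Fin n)) λ post → js ≡ pre ++ z ∷ post × ClosingStep i pre z

  dedup-new : ∀ (xs : List (Edge n)) e ys → e ∉ xs →
    Σ (List (Edge n)) λ Z → deduplicate _≟E_ (xs ++ e ∷ ys) ≡ deduplicate _≟E_ xs ++ e ∷ Z
  dedup-new []       e ys _  = _ , refl
  dedup-new (x ∷ xs) e ys e∉ with dedup-new xs e ys (e∉ ∘ there)
  ... | Z , eq = filter keep? Z , cong (x ∷_) (begin
      filter keep? (deduplicate _≟E_ (xs ++ e ∷ ys))        ≡⟨ cong (filter keep?) eq ⟩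
      filter keep? (deduplicate _≟E_ xs ++ e ∷ Z)           ≡⟨ filter-++ keep? (deduplicate _≟E_ xs) (e ∷ Z) ⟩
      filter keep? (deduplicate _≟E_ xs) ++ filter keep? (e ∷ Z)
        ≡⟨ cong (filter keep? (deduplicate _≟E_ xs) ++_) (filter-accept keep? (λ x≡e → e∉ (here (sym x≡e)))) ⟩
      filter keep? (deduplicate _≟E_ xs) ++ e ∷ filter keep? Z ∎)
    where
    open ≡-Reasoning
    keep? = ¬? ∘ (x ≟E_)

  closing⇒cycleInducing : ∀ {i : Fin n} {js pre z} → ClosingAt i js pre z →
    Σ (Fin (length (minimalEdgeList i js))) λ m →
      lookup (minimalEdgeList i js) m ≡ (endpoint i pre , z) × CycleInducing (minimalEdgeList i js) m
  closing⇒cycleInducing {i} {pre = pre} {z} (post , refl , new , z∈)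
    with dedup-new (edgesOf i pre) (endpoint i pre , z) (edgesOf z post) new
  ... | Z , dedup≡ with position (minimalEdgeList i (pre ++ z ∷ post)) (deduplicate _≟E_ (edgesOf i pre)) _ Z
                          (trans (cong (deduplicate _≟E_) (edgesOf-++ i pre (z ∷ post))) dedup≡)
  ... | m , at , upTo with closingCycle i pre z∈ (take (suc (toℕ m)) (minimalEdgeList i (pre ++ z ∷ post)))
                            (λ e∈ → subst (_ ∈_) (sym upTo) (∈-++⁺ˡ (∈-deduplicate⁺ _≟E_ e∈)))
                            (subst (_ ∈_) (sym upTo) (∈-++⁺ʳ _ (here refl)))
  ... | cs , cycle , e∈cs = m , at , z , cs , cycle , subst (_∈ edgesOf z cs) (sym at) e∈cs

  twoClosings : ∀ {i : Fin n} {js pre₁ z₁ pre₂ z₂} → ClosingAt i js pre₁ z₁ → ClosingAt i js pre₂ z₂ →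
    (endpoint i pre₁ , z₁) ∈ edgesOf i pre₂ → MoreThanOneCycleInducing i js
  twoClosings {i} {js} first second@(_ , _ , new₂ , _) e₁∈
    with closing⇒cycleInducing first | closing⇒cycleInducing second
  ... | m₁ , at₁ , ci₁ | m₂ , at₂ , ci₂ = m₁ , m₂ , distinct , ci₁ , ci₂
    where
    distinct : m₁ ≢ m₂
    distinct m₁≡m₂ = new₂ (subst (_∈ edgesOf i _)
      (trans (sym at₁) (trans (cong (lookup (minimalEdgeList i js)) m₁≡m₂) at₂)) e₁∈)

  freshTail : ∀ {i : Fin n} {js} {e : Edge n} → (∀ {pre z} → e ∈ edgesOf i pre → ¬ ClosingAt i js pre z) →
    ∀ Pre y rest → js ≡ Pre ++ y ∷ rest → (endpoint i Pre , y) ∉ edgesOf i Pre → e ∈ edgesOf i Pre →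
    Disjoint (i ∷ Pre) (y ∷ rest) × Unique (y ∷ rest)
  freshTail {i} noClosing Pre y rest js≡ new e∈ with y ∈? (i ∷ Pre)
  ... | yes y∈ = ⊥-elim (noClosing e∈ (rest , js≡ , new , y∈))
  freshTail {i} noClosing Pre y [] js≡ new e∈ | no y∉ =
    (λ { (v∈ , here refl) → y∉ v∈ }) , [] ∷ []
  freshTail {i} noClosing Pre y (y' ∷ rest) js≡ new e∈ | no y∉
    with freshTail noClosing (Pre ++ [ y ]) y' rest (trans js≡ (sym (++-assoc Pre [ y ] (y' ∷ rest))))
           leavingFresh (edgesOf-prefix i Pre [ y ] e∈)
    where
    -- y is not a source of any edge so far, so no edge out of y is old
    leavingFresh : (endpoint i (Pre ++ [ y ]) , y') ∉ edgesOf i (Pre ++ [ y ])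
    leavingFresh old = y∉ (subst (y ∈_) (sources-snoc i Pre y)
      (∈-map⁺ proj₁ (subst (λ c → (c , y') ∈ edgesOf i (Pre ++ [ y ])) (endpoint-++ i Pre [ y ]) old)))
  ... | disjoint , unique = disjoint' , ¬Any⇒All¬ _ (λ y∈ → disjoint (∈-++⁺ʳ (i ∷ Pre) (here refl) , y∈)) ∷ unique
    where
    disjoint' : Disjoint (i ∷ Pre) (y ∷ y' ∷ rest)
    disjoint' (v∈ , here refl) = y∉ v∈
    disjoint' (v∈ , there w∈)  = disjoint (∈-++⁺ˡ v∈ , w∈)

  firstRepetition : ∀ (i : Fin n) seen xs → Unique (i ∷ seen) →
    Unique (i ∷ seen ++ xs) ⊎ Σ (List (Fin n)) λ pre → Σ (Fin n) λ z → Σ (List (Fin n)) λ q →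
      seen ++ xs ≡ pre ++ z ∷ q × Unique (i ∷ pre) × z ∈ i ∷ pre
  firstRepetition i seen [] u = inj₁ (subst (λ l → Unique (i ∷ l)) (sym (++-identityʳ seen)) u)
  firstRepetition i seen (x ∷ xs) u with x ∈? (i ∷ seen)
  ... | yes x∈ = inj₂ (seen , x , xs , refl , u , x∈)
  ... | no x∉ with firstRepetition i (seen ++ [ x ]) xs (unique-rotate (¬Any⇒All¬ _ x∉ ∷ u))
  ...   | inj₁ u' = inj₁ (subst (λ l → Unique (i ∷ l)) (++-assoc seen [ x ] xs) u')
  ...   | inj₂ (pre , z , q , eq , up , z∈) = inj₂ (pre , z , q , trans (sym (++-assoc seen [ x ] xs)) eq , up , z∈)

  record Lasso (i : Fin n) (js : List (Fin n)) : Set where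
    field
      stem loop rest : List (Fin n)
      root : Fin n
      stem-end : endpoint i stem ≡ root
      split : js ≡ stem ++ loop ++ root ∷ rest
      simple : Unique (i ∷ stem ++ loop)

  simpleOrLasso : ∀ (i : Fin n) js → Unique (i ∷ js) ⊎ Lasso i js
  simpleOrLasso i js with firstRepetition i [] js ([] ∷ [])
  ... | inj₁ u = inj₁ u
  ... | inj₂ (pre , z , q , js≡ , u , z∈) with splitAt∈ i pre z∈
  ...   | stem , loop , refl , end = inj₂ (record
    { stem = stem; loop = loop; rest = q; root = z; stem-end = end
    ; split = trans js≡ (++-assoc stem loop (z ∷ q)); simple = u })

  closingEdge : ∀ {i : Fin n} {js} → Lasso i js → Edge n
  closingEdge {i} L = endpoint i (stem ++ loop) , root  where open Lasso L

  lasso-root∈stem : ∀ {i : Fin n} {js} (L : Lasso i js) → let open Lasso L in root ∈ i ∷ stem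
  lasso-root∈stem {i} L = subst (_∈ i ∷ stem) stem-end (endpoint∈ i stem)  where open Lasso L

  lassoClosing : ∀ {i : Fin n} {js} (L : Lasso i js) → let open Lasso L in ClosingAt i js (stem ++ loop) root
  lassoClosing {i} L = rest , trans split (sym (++-assoc stem loop (root ∷ rest))) ,
    simple-noExit i (stem ++ loop) simple , ∈-++⁺ˡ (lasso-root∈stem L)
    where open Lasso L

  ExitsWithin : List (Fin n) → List (Edge n) → List (Edge n) → Set
  ExitsWithin S es C = ∀ {s t} → (s , t) ∈ es → s ∈ S → (s , t) ∈ C

  exits-++ : ∀ {S es es' C} → ExitsWithin S es C → ExitsWithin S es' C → ExitsWithin S (es ++ es') C
  exits-++ {es = es} ex ex' e∈ s∈ with ∈-++⁻ es e∈
  ... | inj₁ e∈es  = ex e∈es s∈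
  ... | inj₂ e∈es' = ex' e∈es' s∈

  module LassoAnalysis (G : Graph n) {i : Fin n} {js} (path : IsPath G i js) (L : Lasso i js)
    (noLater : ∀ {pre z} → closingEdge L ∈ edgesOf i pre → ¬ ClosingAt i js pre z) where
    open Lasso L

    cs : List (Fin n)
    cs = loop ++ [ root ]

    cycle-closed : endpoint root cs ≡ root
    cycle-closed = endpoint-++ root loop [ root ]

    js≡stem++cs : js ≡ stem ++ cs ++ rest
    js≡stem++cs = trans split (cong (stem ++_) (sym (++-assoc loop [ root ] rest)))

    stem-simple : Unique (i ∷ stem)
    stem-simple = unique-++ˡ (i ∷ stem) simple

    loop-simple : Unique (root ∷ loop)
    loop-simple = ¬Any⇒All¬ loop (λ root∈loop → unique-disjoint (i ∷ stem) simple (lasso-root∈stem L , root∈loop))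
                  ∷ unique-++ʳ (i ∷ stem) simple

    cycle-simple : IsSimpleCycle G root cs
    cycle-simple =
      subst (λ c → IsPath G c cs) stem-end
        (isPath-prefix G _ cs rest (isPath-suffix G i stem (cs ++ rest) (subst (IsPath G i) js≡stem++cs path))) ,
      unique-rotate loop-simple , loop , refl

    stem-exits : ExitsWithin (root ∷ loop) (edgesOf i stem) (edgesOf root cs)
    stem-exits e∈ (here refl) = ⊥-elim (simple-noExit i stem stem-simple (subst (λ c → (c , _) ∈ _) (sym stem-end) e∈))
    stem-exits e∈ (there s∈loop) = ⊥-elim (unique-disjoint (i ∷ stem) simple (source∈ i stem e∈ , s∈loop))

    extend-exits : ∀ P ys → endpoint i P ≡ root → edgesOf root ys ⊆ edgesOf root cs →
      ExitsWithin (root ∷ loop) (edgesOf i P) (edgesOf root cs) →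
      ExitsWithin (root ∷ loop) (edgesOf i (P ++ ys)) (edgesOf root cs)
    extend-exits P ys end ys⊆cs ex e∈ = exits-++ ex (λ e∈ys _ → ys⊆cs (subst (λ c → _ ∈ edgesOf c ys) end e∈ys))
                                          (subst (_ ∈_) (edgesOf-++ i P ys) e∈)

    leaving-isNew : ∀ P a x r' y → endpoint i P ≡ root → cs ≡ a ++ x ∷ r' → y ≢ x →
      ExitsWithin (root ∷ loop) (edgesOf i P) (edgesOf root cs) →
      (endpoint i (P ++ a) , y) ∉ edgesOf i (P ++ a)
    leaving-isNew P a x r' y end cs≡ y≢x ex old = y≢x (cycle-functional root loop root loop-simple cy∈ cx∈)
      where
      c≡ : endpoint i (P ++ a) ≡ endpoint root a
      c≡ = trans (endpoint-++ i P a) (cong (λ c → endpoint c a) end)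
      a⊆cs : edgesOf root a ⊆ edgesOf root cs
      a⊆cs e∈ = subst (λ l → _ ∈ edgesOf root l) (sym cs≡) (edgesOf-prefix root a (x ∷ r') e∈)
      c∈cycle : endpoint root a ∈ root ∷ loop
      c∈cycle with prefix-of-snoc loop root a x r' (sym cs≡)
      ... | t , refl = ∈-++⁺ˡ (endpoint∈ root a)
      cy∈ : (endpoint root a , y) ∈ edgesOf root cs
      cy∈ = extend-exits P a end a⊆cs ex (subst (λ c → (c , y) ∈ _) c≡ old) c∈cycle
      cx∈ : (endpoint root a , x) ∈ edgesOf root cs
      cx∈ = subst (λ l → _ ∈ edgesOf root l) (sym cs≡) (edgesOf-suffix root a (x ∷ r') (here refl))

    tail-simple : ∀ P r → js ≡ P ++ r → endpoint i P ≡ root →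
      ExitsWithin (root ∷ loop) (edgesOf i P) (edgesOf root cs) → closingEdge L ∈ edgesOf i P →
      Deviation cs r → IsSimplePath G root r
    tail-simple P r js≡ end ex e₁∈ record { agreed = a ; unused = r' ; after = after ; expected = x
                                            ; cs-split = cs≡ ; r-split = refl ; leaves = leaves } =
      subst (λ c → IsPath G c (a ++ after)) end (isPath-suffix G i P _ (subst (IsPath G i) js≡ path)) ,
      simple-after after js≡ leaves
      where
      agreed-simple : Unique (root ∷ a)
      agreed-simple with prefix-of-snoc loop root a x r' (sym cs≡)
      ... | t , refl = unique-++ˡ (root ∷ a) loop-simple
      agreed⊆ : ∀ {v} → v ∈ root ∷ a → v ∈ i ∷ P ++ a
      agreed⊆ (here refl) = ∈-++⁺ˡ (subst (_∈ i ∷ P) end (endpoint∈ i P))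
      agreed⊆ (there v∈) = ∈-++⁺ʳ (i ∷ P) v∈
      simple-after : ∀ after → js ≡ P ++ a ++ after → (∀ {y q} → after ≡ y ∷ q → y ≢ x) →
        Unique (root ∷ a ++ after)
      simple-after [] _ _ = subst (λ l → Unique (root ∷ l)) (sym (++-identityʳ a)) agreed-simple
      simple-after (y ∷ q) js≡ leaves with freshTail noLater (P ++ a) y q (trans js≡ (sym (++-assoc P a (y ∷ q))))
                                          (leaving-isNew P a x r' y end cs≡ (leaves refl) ex)
                                          (edgesOf-prefix i P a e₁∈)
      ... | fresh , unique = Unique.++⁺ agreed-simple unique (λ (v∈ , w∈) → fresh (agreed⊆ v∈ , w∈))

    decomposition : Σ (List (Fin n)) λ as → Σ (List (Fin n)) λ bs →
      IsSimplePath G i as × IsSimplePath G (endpoint i as) bs ×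
      ((js ≡ as ++ bs)
       ⊎ Σ (List (Fin n)) λ C → Σ ℕ λ k →
           IsSimpleCycle G (endpoint i as) C × js ≡ as ++ (repeatSteps (suc k) C ++ bs))
    decomposition with peelRounds cs (snoc≢[] loop root) rest
    ... | k , r , refl , deviation =
      stem , r , (isPath-prefix G i stem _ (subst (IsPath G i) js≡ path) , stem-simple) ,
      subst (λ c → IsSimplePath G c r) (sym stem-end) (tail-simple P r js≡P++r P-end P-exits e₁∈P deviation) ,
      inj₂ (cs , k , subst (λ c → IsSimpleCycle G c cs) (sym stem-end) cycle-simple , js≡)
      where
      P = stem ++ repeatSteps (suc k) cs
      js≡ : js ≡ stem ++ (repeatSteps (suc k) cs ++ r)
      js≡ = trans js≡stem++cs (cong (stem ++_) (sym (++-assoc cs (repeatSteps k cs) r)))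
      js≡P++r : js ≡ P ++ r
      js≡P++r = trans js≡ (sym (++-assoc stem _ r))
      P-end : endpoint i P ≡ root
      P-end = trans (endpoint-++ i stem _) (trans (cong (λ c → endpoint c (repeatSteps (suc k) cs)) stem-end)
                (endpoint-repeat root cs (suc k) cycle-closed))
      P-exits : ExitsWithin (root ∷ loop) (edgesOf i P) (edgesOf root cs)
      P-exits = extend-exits stem (repeatSteps (suc k) cs) stem-end (edgesOf-repeat root cs (suc k) cycle-closed) stem-exits
      e₁∈P : closingEdge L ∈ edgesOf i P
      e₁∈P = subst (λ l → closingEdge L ∈ edgesOf i l) (++-assoc stem cs (repeatSteps k cs))
               (edgesOf-prefix i (stem ++ cs) (repeatSteps k cs)
                 (subst (λ l → closingEdge L ∈ edgesOf i l) (++-assoc stem loop [ root ])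
                   (lastEdge∈ i (stem ++ loop) root)))

lemma12 : (n : ℕ) (G : Graph n) (l* : ℕ) →
    ((i : Fin n) (js : List (Fin n)) → IsPath G i js → length js < l* →
    ¬ MoreThanOneCycleInducing i js) →
    (i : Fin n) (js : List (Fin n)) → IsPath G i js → 2 * length js < l* →
    Σ (List (Fin n)) λ as → Σ (List (Fin n)) λ bs →
    IsSimplePath G i as × IsSimplePath G (endpoint i as) bs ×
    ((js ≡ as ++ bs)
    ⊎ Σ (List (Fin n)) λ cs → Σ ℕ λ k →
    IsSimpleCycle G (endpoint i as) cs ×
    js ≡ as ++ (repeatSteps (suc k) cs ++ bs))
lemma12 n G l* fewCycleInducing i js path bound with simpleOrLasso i js
... | inj₁ simple = js , [] , (path , simple) , ([] , [] ∷ []) , inj₁ (sym (++-identityʳ js))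
... | inj₂ L = LassoAnalysis.decomposition G path L noLater
  where
  -- a closing step after the loop's closing edge would give two cycle inducing edges
  noLater : ∀ {pre z} → closingEdge L ∈ edgesOf i pre → ¬ ClosingAt i js pre z
  noLater e₁∈ later = fewCycleInducing i js path (≤-<-trans (m≤n*m (length js) 2) bound)
    (twoClosings (lassoClosing L) later e₁∈)
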